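{- Let $n\ge1$. If $\{H_1,H_2,H_3\}$ is a Hamilton decomposition of $G_{n,3}$ and $\{E_1,\dots,E_n\}$ is a Hamilton decomposition of $Q_{2n}$, then $\{g(E_i,H_j): 1\le i\le n,\ 1\le j\le 3\}$ is a Hamilton decomposition of $Q_{6n}$.
   Context: $G_{n,3}=C_{4^n}\Box C_{4^n}\Box C_{4^n}$: vertices $(x,y,z)$ with coordinates in $\mathbb{Z}/4^n\mathbb{Z}$, adjacent iff they differ in one coordinate by $\pm1$. $Q_{2m}$ is identified with $C_4\Box\cdots\Box C_4$ ($m$ factors): quaternary strings of length $m$, adjacent iff differing in one position by $\pm1\pmod4$. A Hamilton decomposition of a graph is a set of (directed) Hamilton cycles whose edge sets partition the edge set; directed Hamilton cycles start at the origin. Definition of $g$: for a directed Hamilton cycle $E$ of $Q_{2n}$, let $\varphi_E(u)=t$ if $u$ is the $t$-th vertex of $E$ (origin is the $0$-th). Identify $Q_{6n}=Q_{2n}\Box Q_{2n}\Box Q_{2n}$, a vertex $(u,v,w)$ having $u$ on axes $1,\dots,n$, $v$ on axes $n+1,\dots,2n$, $w$ on axes $2n+1,\dots,3n$. The map $(u,v,w)\mapsto(\varphi_E(u),\varphi_E(v),\varphi_E(w))$ is a bijection onto $V(G_{n,3})$ fixing the origin, under which every edge of $G_{n,3}$ pulls back to an edge of $Q_{6n}$; for a directed Hamilton cycle $H$ of $G_{n,3}$, $g(E,H)$ is the Hamilton cycle of $Q_{6n}$ that is the preimage of $H$. -}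

module Defs where

open import Data.Nat using (ℕ; zero; suc; _^_; _*_; _+_)
open import Data.Fin using (Fin; toℕ)
open import Data.Vec using (Vec; lookup; replicate; _++_)
open import Data.Product using (Σ; _×_; _,_; proj₁; proj₂; ∃!)
open import Data.Sum using (_⊎_)
open import Relation.Binary.PropositionalEquality using (_≡_)
open import Relation.Nullary using (¬_)
open import Function.Definitions using (Bijective)

Next : (N : ℕ) → Fin N → Fin N → Set
Next N a b = (suc (toℕ a) ≡ toℕ b) ⊎ ((suc (toℕ a) ≡ N) × (toℕ b ≡ 0))

CycAdj : (N : ℕ) → Fin N → Fin N → Set
CycAdj N a b = Next N a b ⊎ Next N b a

-- Q_{2m} = C_4 □ ... □ C_4 (m factors): quaternary strings of length m.
QVert : ℕ → Set
QVert m = Vec (Fin 4) m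

QAdj : (m : ℕ) → QVert m → QVert m → Set
QAdj m u v = Σ (Fin m) λ p →
  CycAdj 4 (lookup u p) (lookup v p) × (∀ q → ¬ (q ≡ p) → lookup u q ≡ lookup v q)

QOrigin : (m : ℕ) → QVert m → Set
QOrigin m u = u ≡ replicate m Data.Fin.zero

GVert : ℕ → Set
GVert n = Fin (4 ^ n) × Fin (4 ^ n) × Fin (4 ^ n)

GAdj : (n : ℕ) → GVert n → GVert n → Set
GAdj n (x , y , z) (x' , y' , z') =
    (CycAdj (4 ^ n) x x' × y ≡ y' × z ≡ z')
  ⊎ (x ≡ x' × CycAdj (4 ^ n) y y' × z ≡ z')
  ⊎ (x ≡ x' × y ≡ y' × CycAdj (4 ^ n) z z')

GOrigin : (n : ℕ) → GVert n → Set
GOrigin n (x , y , z) = toℕ x ≡ 0 × toℕ y ≡ 0 × toℕ z ≡ 0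

-- Directed Hamilton cycles, given as the sequence of visited vertices
-- c 0, c 1, ..., c (N-1) (then back to c 0), starting at the origin.
IsDirHamCycle : {V : Set} → (V → V → Set) → (V → Set) →
                {N : ℕ} → (Fin N → V) → Set
IsDirHamCycle Adj Origin {N} c =
  Bijective _≡_ _≡_ c
  × (∀ i → toℕ i ≡ 0 → Origin (c i))
  × (∀ i j → Next N i j → Adj (c i) (c j))

EdgeOf : {V : Set} {N : ℕ} → (Fin N → V) → V → V → Set
EdgeOf {N = N} c u v = Σ (Fin N) λ i → Σ (Fin N) λ j →
  Next N i j × ((c i ≡ u × c j ≡ v) ⊎ (c i ≡ v × c j ≡ u))

IsHamDecomp : {I V : Set} → (V → V → Set) → (V → Set) →
              {N : ℕ} → (I → Fin N → V) → Set
IsHamDecomp {I} Adj Origin cs =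
  (∀ k → IsDirHamCycle Adj Origin (cs k))
  × (∀ u v → Adj u v → ∃! _≡_ (λ (k : I) → EdgeOf (cs k) u v))

-- g(E,H): the preimage of H under (u,v,w) ↦ (φ_E u, φ_E v, φ_E w).
-- Since φ_E is the inverse of the vertex sequence E, the t-th vertex of
-- g(E,H) is (E x, E y, E z) where H t = (x,y,z); a vertex (u,v,w) of
-- Q_{6n} = Q_{2n} □ Q_{2n} □ Q_{2n} is the string u ++ v ++ w.
g : {n M : ℕ} → (Fin (4 ^ n) → QVert n) → (Fin M → GVert n) →
    Fin M → QVert (n + (n + n))
g E H t = E (proj₁ (H t)) ++ (E (proj₁ (proj₂ (H t))) ++ E (proj₂ (proj₂ (H t))))

-- For a Hamilton cycle E of Q_{2n}, φ_E is a bijection onto Z/4^n mapping the edges of E exactly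
-- onto the edges of C_{4^n}. Hence (φ_E)³ maps every edge of Q_{6n} that changes one block along an
-- edge of E onto an edge of G_{n,3}, and g(E, H) is a Hamilton cycle of Q_{6n}.
-- An edge of Q_{6n} changes exactly one block, along an edge of Q_{2n} lying in exactly one E_i;
-- its image under (φ_{E_i})³ is an edge of G_{n,3}, lying in exactly one H_j. If the edge also
-- lies on g(E_k, H_j'), its changed block is an edge of E_k, so k = i, and then j' = j.

module Submission where

open import Defs
open import Data.Nat using (ℕ; _^_; _*_; _+_; _≤_)
open import Data.Fin using (Fin)
open import Data.Product using (_×_; proj₁; proj₂)

open import Data.Nat using (zero; suc)
open import Data.Nat.Properties using (1+n≢n)
open import Data.Fin as Fin using ()
open import Data.Fin.Properties using (suc-injective)
open import Data.Vec using (Vec; []; _∷_; _++_; replicate; splitAt)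
open import Data.Vec.Properties using (++-injective; tabulate∘lookup; tabulate-cong)
open import Data.Product using (Σ; ∃; ∃₂; ∃!; _,_)
open import Data.Sum using (_⊎_; inj₁; inj₂)
open import Data.Empty using (⊥-elim)
open import Function using (_∘_)
open import Function.Definitions using (Injective; Bijective)
import Function.Construct.Composition as Compose
open import Relation.Binary.Definitions using (Symmetric)
open import Relation.Binary.PropositionalEquality
open import Relation.Nullary using (¬_)

Box : {X Y : Set} → (X → X → Set) → (Y → Y → Set) → X × Y → X × Y → Set
Box R S (x , y) (x′ , y′) = (R x x′ × y ≡ y′) ⊎ (x ≡ x′ × S y y′)

Box3 : {X : Set} → (X → X → Set) → X × X × X → X × X × X → Set
Box3 R (x , y , z) (x′ , y′ , z′) =
  (R x x′ × y ≡ y′ × z ≡ z′) ⊎ (x ≡ x′ × R y y′ × z ≡ z′) ⊎ (x ≡ x′ × y ≡ y′ × R z z′)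

map3 : {X Y : Set} → (X → Y) → X × X × X → Y × Y × Y
map3 f (x , y , z) = f x , f y , f z

module _ {X : Set} {R : X → X → Set} where

  Box3-sym : (∀ x x′ → R x x′ → R x′ x) → ∀ p p′ → Box3 R p p′ → Box3 R p′ p
  Box3-sym R-sym _ _ (inj₁ (r , refl , refl))         = inj₁ (R-sym _ _ r , refl , refl)
  Box3-sym R-sym _ _ (inj₂ (inj₁ (refl , r , refl))) = inj₂ (inj₁ (refl , R-sym _ _ r , refl))
  Box3-sym R-sym _ _ (inj₂ (inj₂ (refl , refl , r))) = inj₂ (inj₂ (refl , refl , R-sym _ _ r))

  Box3-map : {Y : Set} {S : Y → Y → Set} (f : X → Y) → (∀ {x x′} → R x x′ → S (f x) (f x′)) →
             ∀ p p′ → Box3 R p p′ → Box3 S (map3 f p) (map3 f p′)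
  Box3-map f r _ _ (inj₁ (a , refl , refl))         = inj₁ (r a , refl , refl)
  Box3-map f r _ _ (inj₂ (inj₁ (refl , a , refl))) = inj₂ (inj₁ (refl , r a , refl))
  Box3-map f r _ _ (inj₂ (inj₂ (refl , refl , a))) = inj₂ (inj₂ (refl , refl , r a))

  Box3-map⁻ : {Y : Set} {S : Y → Y → Set} {f : X → Y} → Injective _≡_ _≡_ f →
              (∀ {x x′} → S (f x) (f x′) → R x x′) →
              ∀ p p′ → Box3 S (map3 f p) (map3 f p′) → Box3 R p p′
  Box3-map⁻ inj r _ _ (inj₁ (s , e , e′))         = inj₁ (r s , inj e , inj e′)
  Box3-map⁻ inj r _ _ (inj₂ (inj₁ (e , s , e′))) = inj₂ (inj₁ (inj e , r s , inj e′))
  Box3-map⁻ inj r _ _ (inj₂ (inj₂ (e , e′ , s))) = inj₂ (inj₂ (inj e , inj e′ , r s))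

  Box3-choose : {I : Set} {S : I → X → X → Set} → (∀ {x x′} → R x x′ → Σ I λ i → S i x x′) →
                ∀ p p′ → Box3 R p p′ → Σ I λ i → Box3 (S i) p p′
  Box3-choose s _ _ (inj₁ (r , e , e′))         = let i , a = s r in i , inj₁ (a , e , e′)
  Box3-choose s _ _ (inj₂ (inj₁ (e , r , e′))) = let i , a = s r in i , inj₂ (inj₁ (e , a , e′))
  Box3-choose s _ _ (inj₂ (inj₂ (e , e′ , r))) = let i , a = s r in i , inj₂ (inj₂ (e , e′ , a))

  -- Irreflexivity of R forces both steps from p to p′ onto the same axis.
  Box3-shared : {S : X → X → Set} → (∀ {x} → ¬ R x x) →
                ∀ p p′ → Box3 R p p′ → Box3 S p p′ → ∃₂ λ x x′ → R x x′ × S x x′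
  Box3-shared irr _ _ (inj₁ (r , refl , refl)) (inj₁ (s , _ , _))                 = _ , _ , r , s
  Box3-shared irr _ _ (inj₁ (r , refl , refl)) (inj₂ (inj₁ (refl , _ , _)))       = ⊥-elim (irr r)
  Box3-shared irr _ _ (inj₁ (r , refl , refl)) (inj₂ (inj₂ (refl , _ , _)))       = ⊥-elim (irr r)
  Box3-shared irr _ _ (inj₂ (inj₁ (refl , r , refl))) (inj₁ (_ , refl , _))       = ⊥-elim (irr r)
  Box3-shared irr _ _ (inj₂ (inj₁ (refl , r , refl))) (inj₂ (inj₁ (_ , s , _)))   = _ , _ , r , s
  Box3-shared irr _ _ (inj₂ (inj₁ (refl , r , refl))) (inj₂ (inj₂ (_ , refl , _))) = ⊥-elim (irr r)
  Box3-shared irr _ _ (inj₂ (inj₂ (refl , refl , r))) (inj₁ (_ , _ , refl))       = ⊥-elim (irr r)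
  Box3-shared irr _ _ (inj₂ (inj₂ (refl , refl , r))) (inj₂ (inj₁ (_ , _ , refl))) = ⊥-elim (irr r)
  Box3-shared irr _ _ (inj₂ (inj₂ (refl , refl , r))) (inj₂ (inj₂ (_ , _ , s)))   = _ , _ , r , s

map3-bijective : {X Y : Set} {f : X → Y} → Bijective _≡_ _≡_ f → Bijective _≡_ _≡_ (map3 f)
map3-bijective {f = f} (inj , surj) = injective , surjective
  where
  injective : Injective _≡_ _≡_ (map3 f)
  injective e = cong₂ _,_ (inj (cong proj₁ e))
                          (cong₂ _,_ (inj (cong (proj₁ ∘ proj₂) e)) (inj (cong (proj₂ ∘ proj₂) e)))
  surjective : ∀ q → ∃ λ p → ∀ {p′} → p′ ≡ p → map3 f p′ ≡ q
  surjective (a , b , c) =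
    let x , fx≡a = surj a ; y , fy≡b = surj b ; z , fz≡c = surj c
    in (x , y , z) , λ { refl → cong₂ _,_ (fx≡a refl) (cong₂ _,_ (fy≡b refl) (fz≡c refl)) }

append3 : {A : Set} {n : ℕ} → Vec A n × Vec A n × Vec A n → Vec A (n + (n + n))
append3 (a , b , c) = a ++ (b ++ c)

append3-bijective : {A : Set} {n : ℕ} → Bijective _≡_ _≡_ (append3 {A} {n})
append3-bijective {n = n} = injective , surjective
  where
  injective : Injective _≡_ _≡_ append3
  injective {a , b , c} {a′ , b′ , c′} e with ++-injective a a′ e
  ... | refl , e′ with ++-injective b b′ e′
  ...   | refl , refl = refl
  surjective : ∀ u → ∃ λ p → ∀ {p′} → p′ ≡ p → append3 p′ ≡ u
  surjective u with splitAt n u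
  ... | a , v , refl with splitAt n v
  ...   | b , c , refl = (a , b , c) , λ { refl → refl }

append3-split : {A : Set} {n : ℕ} (u : Vec A (n + (n + n))) → ∃ λ p → append3 p ≡ u
append3-split {n = n} u = let p , append3-p≡u = proj₂ (append3-bijective {n = n}) u in p , append3-p≡u refl

replicate-++ : {A : Set} (m k : ℕ) (x : A) → replicate m x ++ replicate k x ≡ replicate (m + k) x
replicate-++ zero    k x = refl
replicate-++ (suc m) k x = cong (x ∷_) (replicate-++ m k x)

append3-replicate : {A : Set} (n : ℕ) (x : A) →
                    append3 (replicate n x , replicate n x , replicate n x) ≡ replicate (n + (n + n)) x
append3-replicate n x = trans (cong (replicate n x ++_) (replicate-++ n n x)) (replicate-++ n (n + n) x)

Next-irrefl : {N : ℕ} → N ≢ 1 → {a : Fin N} → ¬ Next N a a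
Next-irrefl N≢1 (inj₁ 1+a≡a)          = 1+n≢n 1+a≡a
Next-irrefl N≢1 (inj₂ (1+a≡N , a≡0)) = N≢1 (trans (sym 1+a≡N) (cong suc a≡0))

CycAdj-sym : {N : ℕ} → Symmetric (CycAdj N)
CycAdj-sym (inj₁ next) = inj₂ next
CycAdj-sym (inj₂ next) = inj₁ next

QAdj-sym : {m : ℕ} (u v : QVert m) → QAdj m u v → QAdj m v u
QAdj-sym _ _ (p , c , same) = p , CycAdj-sym c , λ q q≢p → sym (same q q≢p)

QAdj-irrefl : {m : ℕ} {u : QVert m} → ¬ QAdj m u u
QAdj-irrefl (_ , inj₁ next , _) = Next-irrefl (λ ()) next
QAdj-irrefl (_ , inj₂ next , _) = Next-irrefl (λ ()) next

QAdj-∷⁺ : {m : ℕ} {x x′ : Fin 4} {u u′ : QVert m} →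
          Box (CycAdj 4) (QAdj m) (x , u) (x′ , u′) → QAdj (suc m) (x ∷ u) (x′ ∷ u′)
QAdj-∷⁺ (inj₁ (c , refl)) = Fin.zero , c , λ { Fin.zero 0≢0 → ⊥-elim (0≢0 refl) ; (Fin.suc q) _ → refl }
QAdj-∷⁺ (inj₂ (refl , (p , c , same))) =
  Fin.suc p , c , λ { Fin.zero _ → refl ; (Fin.suc q) q≢p → same q (q≢p ∘ cong Fin.suc) }

QAdj-∷⁻ : {m : ℕ} {x x′ : Fin 4} {u u′ : QVert m} →
          QAdj (suc m) (x ∷ u) (x′ ∷ u′) → Box (CycAdj 4) (QAdj m) (x , u) (x′ , u′)
QAdj-∷⁻ {u = u} {u′} (Fin.zero , c , same) =
  inj₁ (c , trans (sym (tabulate∘lookup u))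
                  (trans (tabulate-cong λ q → same (Fin.suc q) λ ()) (tabulate∘lookup u′)))
QAdj-∷⁻ (Fin.suc p , c , same) =
  inj₂ (same Fin.zero (λ ()) , p , c , λ q q≢p → same (Fin.suc q) (q≢p ∘ suc-injective))

QAdj-++⁺ : {m k : ℕ} (a a′ : QVert m) {b b′ : QVert k} →
           Box (QAdj m) (QAdj k) (a , b) (a′ , b′) → QAdj (m + k) (a ++ b) (a′ ++ b′)
QAdj-++⁺ []      []       (inj₁ ((() , _) , _))
QAdj-++⁺ []      []       (inj₂ (refl , adj)) = adj
QAdj-++⁺ (_ ∷ a) (_ ∷ a′) (inj₁ (adj , refl)) with QAdj-∷⁻ adj
... | inj₁ (c , refl)    = QAdj-∷⁺ (inj₁ (c , refl))
... | inj₂ (refl , adj′) = QAdj-∷⁺ (inj₂ (refl , QAdj-++⁺ a a′ (inj₁ (adj′ , refl))))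
QAdj-++⁺ (_ ∷ a) (_ ∷ a′) (inj₂ (refl , adj)) = QAdj-∷⁺ (inj₂ (refl , QAdj-++⁺ a a (inj₂ (refl , adj))))

QAdj-++⁻ : {m k : ℕ} (a a′ : QVert m) {b b′ : QVert k} →
           QAdj (m + k) (a ++ b) (a′ ++ b′) → Box (QAdj m) (QAdj k) (a , b) (a′ , b′)
QAdj-++⁻ []      []       adj = inj₂ (refl , adj)
QAdj-++⁻ (_ ∷ a) (_ ∷ a′) adj with QAdj-∷⁻ adj
... | inj₁ (c , e) with ++-injective a a′ e
...   | refl , refl = inj₁ (QAdj-∷⁺ (inj₁ (c , refl)) , refl)
QAdj-++⁻ (_ ∷ a) (_ ∷ a′) adj | inj₂ (refl , adj′) with QAdj-++⁻ a a′ adj′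
...   | inj₁ (adj″ , refl) = inj₁ (QAdj-∷⁺ (inj₂ (refl , adj″)) , refl)
...   | inj₂ (refl , adj″) = inj₂ (refl , adj″)

QAdj-append3⁺ : {n : ℕ} (p p′ : QVert n × QVert n × QVert n) →
                Box3 (QAdj n) p p′ → QAdj (n + (n + n)) (append3 p) (append3 p′)
QAdj-append3⁺ (a , b , _) (a′ , _ , _) (inj₁ (adj , refl , refl)) =
  QAdj-++⁺ a a′ (inj₁ (adj , refl))
QAdj-append3⁺ (a , b , _) (_ , b′ , _) (inj₂ (inj₁ (refl , adj , refl))) =
  QAdj-++⁺ a a (inj₂ (refl , QAdj-++⁺ b b′ (inj₁ (adj , refl))))
QAdj-append3⁺ (a , b , _) (_ , _ , _) (inj₂ (inj₂ (refl , refl , adj))) =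
  QAdj-++⁺ a a (inj₂ (refl , QAdj-++⁺ b b (inj₂ (refl , adj))))

QAdj-append3⁻ : {n : ℕ} (p p′ : QVert n × QVert n × QVert n) →
                QAdj (n + (n + n)) (append3 p) (append3 p′) → Box3 (QAdj n) p p′
QAdj-append3⁻ (a , b , c) (a′ , b′ , c′) adj with QAdj-++⁻ a a′ adj
... | inj₁ (adj′ , e) with ++-injective b b′ e
...   | refl , refl = inj₁ (adj′ , refl , refl)
QAdj-append3⁻ (a , b , c) (a′ , b′ , c′) adj | inj₂ (refl , adj′) with QAdj-++⁻ b b′ adj′
...   | inj₁ (adj″ , refl) = inj₂ (inj₁ (refl , adj″ , refl))
...   | inj₂ (refl , adj″) = inj₂ (inj₂ (refl , refl , adj″))

module _ {V : Set} {N : ℕ} {c : Fin N → V} where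

  EdgeOf⇒Adj : {Adj : V → V → Set} → (∀ u v → Adj u v → Adj v u) →
               (∀ i j → Next N i j → Adj (c i) (c j)) → ∀ {u v} → EdgeOf c u v → Adj u v
  EdgeOf⇒Adj adj-sym adj (i , j , next , inj₁ (refl , refl)) = adj i j next
  EdgeOf⇒Adj adj-sym adj (i , j , next , inj₂ (refl , refl)) = adj-sym _ _ (adj i j next)

  EdgeOf-map : {W : Set} (f : V → W) → ∀ {u v} → EdgeOf c u v → EdgeOf (f ∘ c) (f u) (f v)
  EdgeOf-map f (i , j , next , inj₁ (refl , refl)) = i , j , next , inj₁ (refl , refl)
  EdgeOf-map f (i , j , next , inj₂ (refl , refl)) = i , j , next , inj₂ (refl , refl)

  EdgeOf-unmap : {W : Set} {f : V → W} → Injective _≡_ _≡_ f →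
                 ∀ {u v} → EdgeOf (f ∘ c) (f u) (f v) → EdgeOf c u v
  EdgeOf-unmap inj (i , j , next , inj₁ (e , e′)) = i , j , next , inj₁ (inj e , inj e′)
  EdgeOf-unmap inj (i , j , next , inj₂ (e , e′)) = i , j , next , inj₂ (inj e , inj e′)

-- position is the map φ_E of the paper: the inverse of the vertex sequence.
module Position {V : Set} {N : ℕ} {c : Fin N → V} (c-bijective : Bijective _≡_ _≡_ c) where

  position : V → Fin N
  position v = proj₁ (proj₂ c-bijective v)

  c-position : ∀ v → c (position v) ≡ v
  c-position v = proj₂ (proj₂ c-bijective v) refl

  position-c : ∀ i → position (c i) ≡ i
  position-c i = proj₁ c-bijective (c-position (c i))

  position-injective : Injective _≡_ _≡_ position
  position-injective {u} {v} e = trans (sym (c-position u)) (trans (cong c e) (c-position v))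

  Next-positions : ∀ {i j} → Next N i j → Next N (position (c i)) (position (c j))
  Next-positions {i} {j} = subst₂ (Next N) (sym (position-c i)) (sym (position-c j))

  EdgeOf⇒CycAdj : ∀ {u v} → EdgeOf c u v → CycAdj N (position u) (position v)
  EdgeOf⇒CycAdj (i , j , next , inj₁ (refl , refl)) = inj₁ (Next-positions next)
  EdgeOf⇒CycAdj (i , j , next , inj₂ (refl , refl)) = inj₂ (Next-positions next)

  CycAdj⇒EdgeOf : ∀ {u v} → CycAdj N (position u) (position v) → EdgeOf c u v
  CycAdj⇒EdgeOf {u} {v} (inj₁ next) = position u , position v , next , inj₁ (c-position u , c-position v)
  CycAdj⇒EdgeOf {u} {v} (inj₂ next) = position v , position u , next , inj₂ (c-position v , c-position u)

IsHamDecomp-unique : {I V : Set} {Adj : V → V → Set} {Origin : V → Set} {N : ℕ}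
                     {cs : I → Fin N → V} →
                     (∀ u v → Adj u v → Adj v u) → IsHamDecomp Adj Origin cs →
                     ∀ {i k u v} → EdgeOf (cs i) u v → EdgeOf (cs k) u v → i ≡ k
IsHamDecomp-unique adj-sym (hamiltonian , unique) {i} e e′ =
  let _ , _ , owner-unique = unique _ _ (EdgeOf⇒Adj adj-sym (proj₂ (proj₂ (hamiltonian i))) e)
  in trans (sym (owner-unique e)) (owner-unique e′)

-- g E H is definitionally gVertex E ∘ H.
gVertex : {n : ℕ} → (Fin (4 ^ n) → QVert n) → GVert n → QVert (n + (n + n))
gVertex E = append3 ∘ map3 E

GAdj-sym : {n : ℕ} (P Q : GVert n) → GAdj n P Q → GAdj n Q P
GAdj-sym = Box3-sym (λ _ _ → CycAdj-sym)

module _ {n : ℕ} {E : Fin (4 ^ n) → QVert n} (E-cycle : IsDirHamCycle (QAdj n) (QOrigin n) E) where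

  gVertex-bijective : Bijective _≡_ _≡_ (gVertex E)
  gVertex-bijective = Compose.bijective _≡_ _≡_ _≡_ (map3-bijective (proj₁ E-cycle)) append3-bijective

  gVertex-origin : ∀ Q → GOrigin n Q → QOrigin (n + (n + n)) (gVertex E Q)
  gVertex-origin (x , y , z) (x≡0 , y≡0 , z≡0)
    rewrite proj₁ (proj₂ E-cycle) x x≡0 | proj₁ (proj₂ E-cycle) y y≡0 | proj₁ (proj₂ E-cycle) z z≡0 =
    append3-replicate n Fin.zero

  CycAdj⇒QAdj : ∀ {s t} → CycAdj (4 ^ n) s t → QAdj n (E s) (E t)
  CycAdj⇒QAdj (inj₁ next) = proj₂ (proj₂ E-cycle) _ _ next
  CycAdj⇒QAdj {s} {t} (inj₂ next) = QAdj-sym (E t) (E s) (proj₂ (proj₂ E-cycle) t s next)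

  g-isDirHamCycle : {M : ℕ} {H : Fin M → GVert n} → IsDirHamCycle (GAdj n) (GOrigin n) H →
                    IsDirHamCycle (QAdj (n + (n + n))) (QOrigin (n + (n + n))) (g E H)
  g-isDirHamCycle (H-bijective , H-origin , H-adj) =
    Compose.bijective _≡_ _≡_ _≡_ H-bijective gVertex-bijective ,
    (λ t t≡0 → gVertex-origin _ (H-origin t t≡0)) ,
    λ t t′ next → QAdj-append3⁺ _ _ (Box3-map {S = QAdj n} E CycAdj⇒QAdj _ _ (H-adj t t′ next))

module _ {n M : ℕ} {I J : Set} {E : I → Fin (4 ^ n) → QVert n} {H : J → Fin M → GVert n}
         (E-decomp : IsHamDecomp (QAdj n) (QOrigin n) E)
         (H-decomp : IsHamDecomp (GAdj n) (GOrigin n) H) where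

  private
    E-cycle : ∀ i → IsDirHamCycle (QAdj n) (QOrigin n) (E i)
    E-cycle = proj₁ E-decomp

    module Pos (i : I) = Position (proj₁ (E-cycle i))

    φ : I → QVert n → Fin (4 ^ n)
    φ = Pos.position

  gVertex-φ : ∀ i p → gVertex (E i) (map3 (φ i) p) ≡ append3 p
  gVertex-φ i (a , b , c) =
    cong append3 (cong₂ _,_ (Pos.c-position i a) (cong₂ _,_ (Pos.c-position i b) (Pos.c-position i c)))

  E-edge-irrefl : ∀ i {u} → ¬ EdgeOf (E i) u u
  E-edge-irrefl i {u} e = QAdj-irrefl {u = u} (EdgeOf⇒Adj QAdj-sym (proj₂ (proj₂ (E-cycle i))) e)

  H-edge⇒g-edge : ∀ i j p p′ → EdgeOf (H j) (map3 (φ i) p) (map3 (φ i) p′) →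
                  EdgeOf (g (E i) (H j)) (append3 p) (append3 p′)
  H-edge⇒g-edge i j p p′ e =
    subst₂ (EdgeOf (g (E i) (H j))) (gVertex-φ i p) (gVertex-φ i p′) (EdgeOf-map (gVertex (E i)) e)

  g-edge⇒H-edge : ∀ i j p p′ → EdgeOf (g (E i) (H j)) (append3 p) (append3 p′) →
                  EdgeOf (H j) (map3 (φ i) p) (map3 (φ i) p′)
  g-edge⇒H-edge i j p p′ e =
    EdgeOf-unmap (proj₁ (gVertex-bijective (E-cycle i)))
      (subst₂ (EdgeOf (g (E i) (H j))) (sym (gVertex-φ i p)) (sym (gVertex-φ i p′)) e)

  g-edge⇒E-edges : ∀ i j p p′ → EdgeOf (g (E i) (H j)) (append3 p) (append3 p′) →
                   Box3 (EdgeOf (E i)) p p′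
  g-edge⇒E-edges i j p p′ e =
    Box3-map⁻ {S = CycAdj (4 ^ n)} (Pos.position-injective i) (Pos.CycAdj⇒EdgeOf i) p p′
      (EdgeOf⇒Adj (GAdj-sym {n}) (proj₂ (proj₂ (proj₁ H-decomp j))) (g-edge⇒H-edge i j p p′ e))

  g-edge-unique : ∀ p p′ → Box3 (QAdj n) p p′ →
                  ∃! _≡_ λ (ij : I × J) → EdgeOf (g (E (proj₁ ij)) (H (proj₂ ij))) (append3 p) (append3 p′)
  g-edge-unique p p′ adj = (i , j) , H-edge⇒g-edge i j p p′ j-edge , unique
    where
    E-owner : ∀ {u u′} → QAdj n u u′ → Σ I λ i → EdgeOf (E i) u u′
    E-owner {u} {u′} adj = let i , e , _ = proj₂ E-decomp u u′ adj in i , e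

    i-edges : Σ I λ i → Box3 (EdgeOf (E i)) p p′
    i-edges = Box3-choose {S = λ i → EdgeOf (E i)} E-owner p p′ adj

    i : I
    i = proj₁ i-edges

    H-owner : ∃! _≡_ λ j → EdgeOf (H j) (map3 (φ i) p) (map3 (φ i) p′)
    H-owner = proj₂ H-decomp _ _
      (Box3-map {S = CycAdj (4 ^ n)} (φ i) (Pos.EdgeOf⇒CycAdj i) p p′ (proj₂ i-edges))

    j : J
    j = proj₁ H-owner

    j-edge : EdgeOf (H j) (map3 (φ i) p) (map3 (φ i) p′)
    j-edge = proj₁ (proj₂ H-owner)

    unique : ∀ {kj′} → EdgeOf (g (E (proj₁ kj′)) (H (proj₂ kj′))) (append3 p) (append3 p′) →
             (i , j) ≡ kj′
    unique {k , j′} e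
      with Box3-shared (E-edge-irrefl i) p p′ (proj₂ i-edges) (g-edge⇒E-edges k j′ p p′ e)
    ... | _ , _ , e-i , e-k with IsHamDecomp-unique {Origin = QOrigin n} QAdj-sym E-decomp e-i e-k
    ...   | refl =
      cong (i ,_) (IsHamDecomp-unique {Origin = GOrigin n} (GAdj-sym {n}) H-decomp j-edge
                                      (g-edge⇒H-edge i j′ p p′ e))

  g-isHamDecomp : IsHamDecomp (QAdj (n + (n + n))) (QOrigin (n + (n + n)))
                    (λ (ij : I × J) → g (E (proj₁ ij)) (H (proj₂ ij)))
  g-isHamDecomp = (λ (i , j) → g-isDirHamCycle (E-cycle i) (proj₁ H-decomp j)) , every-edge-once
    where
    every-edge-once : ∀ U U′ → QAdj (n + (n + n)) U U′ →
                      ∃! _≡_ λ (ij : I × J) → EdgeOf (g (E (proj₁ ij)) (H (proj₂ ij))) U U′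
    every-edge-once U U′ adj with append3-split {n = n} U | append3-split {n = n} U′
    ... | p , refl | p′ , refl = g-edge-unique p p′ (QAdj-append3⁻ p p′ adj)

corollary2 : (n : ℕ) → 1 ≤ n →
    (H : Fin 3 → Fin (4 ^ n * 4 ^ n * 4 ^ n) → GVert n) →
    (E : Fin n → Fin (4 ^ n) → QVert n) →
    IsHamDecomp (GAdj n) (GOrigin n) H →
    IsHamDecomp (QAdj n) (QOrigin n) E →
    IsHamDecomp (QAdj (n + (n + n))) (QOrigin (n + (n + n)))
      (λ (ij : Fin n × Fin 3) → g (E (proj₁ ij)) (H (proj₂ ij)))
corollary2 n _ H E H-decomp E-decomp = g-isHamDecomp E-decomp H-decomp
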